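{- Let $G$ be a cubic graph on $n \ge 8$ vertices that has a self-identifying code. If $\mathrm{SIC}(G) = n$, then $n = 6k$ for some positive integer $k$.
   Context: All graphs are finite, simple, undirected and connected; a cubic graph is 3-regular. $N[v] = N(v) \cup \{v\}$; $N_S[v] = N[v] \cap S$. A set $S \subseteq V(G)$ is a self-identifying code (SIC) if for every $x \in V(G)$, $N_S[x] \neq \varnothing$ and $\bigcap_{v \in N_S[x]} N[v] = \{x\}$; $\mathrm{SIC}(G)$ is the minimum cardinality of an SIC. -}

module Defs where

open import Data.Nat using (ℕ; _≤_)
open import Data.Bool using (Bool; true; false; T)
open import Data.Fin using (Fin)
open import Data.Fin.Subset using (Subset; _∈_; ∣_∣)
open import Data.Vec using (tabulate)
open import Data.Product using (Σ; ∃; _×_; _,_)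
open import Data.Sum using (_⊎_)
open import Relation.Binary.PropositionalEquality using (_≡_)
open import Relation.Binary.Construct.Closure.ReflexiveTransitive using (Star)

record Graph (n : ℕ) : Set where
  field
    adj     : Fin n → Fin n → Bool
    irrefl  : ∀ v → adj v v ≡ false
    sym     : ∀ u v → adj u v ≡ adj v u

module _ {n : ℕ} (G : Graph n) where
  open Graph G

  Adj : Fin n → Fin n → Set
  Adj u v = T (adj u v)

  N : Fin n → Subset n
  N v = tabulate (adj v)

  _∈N[_] : Fin n → Fin n → Set
  u ∈N[ v ] = (u ≡ v) ⊎ Adj v u

  Connected : Set
  Connected = ∀ u v → Star Adj u v

  Cubic : Set
  Cubic = ∀ v → ∣ N v ∣ ≡ 3

  -- S is a self-identifying code: for every x, N_S[x] ≠ ∅ and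
  -- ⋂_{v ∈ N_S[x]} N[v] = {x}.
  IsSIC : Subset n → Set
  IsSIC S = ∀ x →
      (∃ λ v → v ∈ S × v ∈N[ x ])
    × (∀ y → (∀ v → v ∈ S → v ∈N[ x ] → y ∈N[ v ]) → y ≡ x)
    × (∀ v → v ∈ S → v ∈N[ x ] → x ∈N[ v ])

  SICNumber : ℕ → Set
  SICNumber m = (Σ (Subset n) λ S → IsSIC S × ∣ S ∣ ≡ m)
              × (∀ S → IsSIC S → m ≤ ∣ S ∣)

-- Since SIC(G) = n, the whole vertex set V is a minimum SIC: no closed
-- neighbourhood contains another, yet for every v the set V - v fails, so some
-- x ≠ y satisfy N[x] - v ⊆ N[y]. In a cubic graph such a pair either makes v a
-- twin of y or puts v on a triangle; a twin forces the component of v to be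
-- K₃,₃, impossible in a connected graph on n ≥ 8 vertices. Hence every vertex
-- lies on a triangle, which is unique since two triangles sharing an edge xy
-- would give N[x] ⊆ N[y]. The triangles partition V, so 3 ∣ n, and the
-- remaining edge at each vertex forms a perfect matching, so 2 ∣ n.

module Submission where

open import Defs hiding (_∈N[_])
import Defs
open import Level using (Level; 0ℓ)
open import Data.Nat using (ℕ; zero; suc; _+_; _*_; _≤_; _<_; z≤n; s≤s)
import Data.Nat.Properties as ℕₚ
open import Data.Nat.Divisibility using (_∣_; divides)
open import Data.Nat.LCM using (lcm-least)
open import Data.Bool using (Bool; true; false; T; if_then_else_)
open import Data.Fin using (Fin; zero; suc; _≟_; punchIn)
import Data.Fin.Properties as Finₚ
import Data.Fin as Fin
open import Data.Fin.Subset using (⊤; _-_; ∣_∣) renaming (_∈_ to _∈ₛ_)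
import Data.Fin.Subset.Properties as Subsetₚ
open import Data.Vec using (tabulate)
open import Data.List using (List; []; _∷_; _++_; length; lookup)
open import Data.List.Relation.Unary.All using (All; []; _∷_)
import Data.List.Relation.Unary.All as All
open import Data.List.Relation.Unary.All.Properties using (All¬⇒¬Any; ¬Any⇒All¬)
open import Data.List.Relation.Unary.Any using (here; there; toSum; fromSum; index)
open import Data.List.Relation.Unary.Any.Properties using (lookup-index)
open import Data.List.Relation.Unary.Unique.Propositional using (Unique; []; _∷_)
open import Data.List.Membership.Propositional using (_∈_; _∉_)
open import Data.List.Membership.Propositional.Properties using (∈-++⁺ˡ; ∈-++⁺ʳ)
import Data.List.Membership.DecPropositional as DecMembership
open import Data.Product using (∃; ∃₂; _×_; _,_; proj₁; proj₂)
open import Data.Sum using (_⊎_; inj₁; inj₂)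
open import Data.Empty using (⊥; ⊥-elim)
open import Function using (_∘_)
open import Relation.Nullary using (¬_; Dec; yes; no; does; contradiction)
open import Relation.Nullary.Decidable using (_×-dec_; _⊎-dec_; _→-dec_; ¬?; T?; decidable-stable)
open import Relation.Unary using (Pred; Decidable)
open import Relation.Binary using (Rel; IsDecEquivalence)
open import Relation.Binary.PropositionalEquality
  using (_≡_; _≢_; refl; sym; trans; cong; cong₂; subst; module ≡-Reasoning)
open import Relation.Binary.Construct.Closure.ReflexiveTransitive using (Star; ε; _◅_)
open import Algebra.Properties.Semiring.Sum ℕₚ.+-*-semiring
  using (sum-syntax; sum-cong-≗; sum-remove; ∑-distrib-+; ∑-comm; *-distribʳ-sum)

private variable
  ℓ₁ ℓ₂ : Level
  A : Set ℓ₁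
  B : Set ℓ₂

-- Counting over Fin n

infix 4 _∈?_
_∈?_ : ∀ {n} (x : Fin n) (xs : List (Fin n)) → Dec (x ∈ xs)
_∈?_ = DecMembership._∈?_ _≟_

indicator : Dec A → ℕ
indicator a? = if does a? then 1 else 0

indicator-yes : (a? : Dec A) → A → indicator a? ≡ 1
indicator-yes (yes _) _ = refl
indicator-yes (no ¬a) a = contradiction a ¬a

indicator-no : (a? : Dec A) → ¬ A → indicator a? ≡ 0
indicator-no (yes a) ¬a = contradiction a ¬a
indicator-no (no _)  _  = refl

indicator-mono : (a? : Dec A) (b? : Dec B) → (A → B) → indicator a? ≤ indicator b?
indicator-mono (yes a) b? f = ℕₚ.≤-reflexive (sym (indicator-yes b? (f a)))
indicator-mono (no _)  b? f = z≤n

indicator-cong : (a? : Dec A) (b? : Dec B) → (A → B) → (B → A) → indicator a? ≡ indicator b?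
indicator-cong a? b? f g = ℕₚ.≤-antisym (indicator-mono a? b? f) (indicator-mono b? a? g)

indicator-× : (a? : Dec A) (b? : Dec B) → indicator (a? ×-dec b?) ≡ indicator a? * indicator b?
indicator-× (yes _) (yes _) = refl
indicator-× (yes _) (no _)  = refl
indicator-× (no _)  _       = refl

indicator-⊎-≤ : (a? : Dec A) (b? : Dec B) → indicator (a? ⊎-dec b?) ≤ indicator a? + indicator b?
indicator-⊎-≤ (yes _) _       = s≤s z≤n
indicator-⊎-≤ (no _)  (yes _) = s≤s z≤n
indicator-⊎-≤ (no _)  (no _)  = z≤n

indicator-⊎ : (a? : Dec A) (b? : Dec B) → ¬ (A × B) →
              indicator (a? ⊎-dec b?) ≡ indicator a? + indicator b?
indicator-⊎ (yes a) (yes b) ¬ab = contradiction (a , b) ¬ab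
indicator-⊎ (yes _) (no _)  _   = refl
indicator-⊎ (no _)  (yes _) _   = refl
indicator-⊎ (no _)  (no _)  _   = refl

∑-const : ∀ n c → ∑[ i < n ] c ≡ n * c
∑-const zero    c = refl
∑-const (suc n) c = cong (c +_) (∑-const n c)

∑-mono : ∀ {n} {f g : Fin n → ℕ} → (∀ i → f i ≤ g i) → ∑[ i < n ] f i ≤ ∑[ i < n ] g i
∑-mono {zero}  f≤g = z≤n
∑-mono {suc n} f≤g = ℕₚ.+-mono-≤ (f≤g zero) (∑-mono (f≤g ∘ suc))

count : ∀ {n p} {P : Pred (Fin n) p} → Decidable P → ℕ
count {n} P? = ∑[ i < n ] indicator (P? i)

module _ {n p q} {P : Pred (Fin n) p} {Q : Pred (Fin n) q} (P? : Decidable P) (Q? : Decidable Q) where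

  count-mono : (∀ {i} → P i → Q i) → count P? ≤ count Q?
  count-mono P⇒Q = ∑-mono λ i → indicator-mono (P? i) (Q? i) P⇒Q

  count-cong : (∀ {i} → P i → Q i) → (∀ {i} → Q i → P i) → count P? ≡ count Q?
  count-cong P⇒Q Q⇒P = sum-cong-≗ λ i → indicator-cong (P? i) (Q? i) P⇒Q Q⇒P

count-≟ : ∀ {n} (w : Fin n) → count (_≟ w) ≡ 1
count-≟ {suc n} w = begin
  count (_≟ w)
    ≡⟨ sum-remove {i = w} (λ i → indicator (i ≟ w)) ⟩
  indicator (w ≟ w) + ∑[ j < n ] indicator (punchIn w j ≟ w)
    ≡⟨ cong₂ _+_ (indicator-yes (w ≟ w) refl) (sum-cong-≗ w≢punchIn) ⟩
  1 + ∑[ j < n ] 0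
    ≡⟨ cong (1 +_) (trans (∑-const n 0) (ℕₚ.*-zeroʳ n)) ⟩
  1 ∎
  where
  open ≡-Reasoning
  w≢punchIn : ∀ j → indicator (punchIn w j ≟ w) ≡ 0
  w≢punchIn j = indicator-no (punchIn w j ≟ w) (Finₚ.punchInᵢ≢i w j)

count-unique : ∀ {n p} {P : Pred (Fin n) p} (P? : Decidable P) {w} →
               P w → (∀ {i} → P i → i ≡ w) → count P? ≡ 1
count-unique P? {w} Pw unique = trans (count-cong P? (_≟ w) unique λ { refl → Pw }) (count-≟ w)

count-∈-≤ : ∀ {n} (xs : List (Fin n)) → count (_∈? xs) ≤ length xs
count-∈-≤ {n} [] = ℕₚ.≤-reflexive (trans (∑-const n 0) (ℕₚ.*-zeroʳ n))
count-∈-≤ {n} (x ∷ xs) = begin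
  count (_∈? x ∷ xs)
    ≤⟨ ∑-mono split ⟩
  ∑[ i < n ] (indicator (i ≟ x) + indicator (i ∈? xs))
    ≡⟨ ∑-distrib-+ (λ i → indicator (i ≟ x)) (λ i → indicator (i ∈? xs)) ⟩
  count (_≟ x) + count (_∈? xs)
    ≤⟨ ℕₚ.+-mono-≤ (ℕₚ.≤-reflexive (count-≟ x)) (count-∈-≤ xs) ⟩
  suc (length xs) ∎
  where
  open ℕₚ.≤-Reasoning
  split : ∀ i → indicator (i ∈? x ∷ xs) ≤ indicator (i ≟ x) + indicator (i ∈? xs)
  split i = ℕₚ.≤-trans
    (ℕₚ.≤-reflexive (indicator-cong (i ∈? x ∷ xs) ((i ≟ x) ⊎-dec (i ∈? xs)) toSum fromSum))
    (indicator-⊎-≤ (i ≟ x) (i ∈? xs))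

count-∈ : ∀ {n} {xs : List (Fin n)} → Unique xs → count (_∈? xs) ≡ length xs
count-∈ {n} {[]} [] = trans (∑-const n 0) (ℕₚ.*-zeroʳ n)
count-∈ {n} {x ∷ xs} (x∉xs ∷ !xs) = begin
  count (_∈? x ∷ xs)
    ≡⟨ sum-cong-≗ split ⟩
  ∑[ i < n ] (indicator (i ≟ x) + indicator (i ∈? xs))
    ≡⟨ ∑-distrib-+ (λ i → indicator (i ≟ x)) (λ i → indicator (i ∈? xs)) ⟩
  count (_≟ x) + count (_∈? xs)
    ≡⟨ cong₂ _+_ (count-≟ x) (count-∈ !xs) ⟩
  suc (length xs) ∎
  where
  open ≡-Reasoning
  split : ∀ i → indicator (i ∈? x ∷ xs) ≡ indicator (i ≟ x) + indicator (i ∈? xs)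
  split i = trans (indicator-cong (i ∈? x ∷ xs) ((i ≟ x) ⊎-dec (i ∈? xs)) toSum fromSum)
                  (indicator-⊎ (i ≟ x) (i ∈? xs) λ { (refl , i∈xs) → All¬⇒¬Any x∉xs i∈xs })

module _ {n p} {P : Pred (Fin n) p} (P? : Decidable P) where

  unique-members⇒length≤count : ∀ {xs} → Unique xs → All P xs → length xs ≤ count P?
  unique-members⇒length≤count {xs} !xs Pxs =
    ℕₚ.≤-trans (ℕₚ.≤-reflexive (sym (count-∈ !xs))) (count-mono (_∈? xs) P? (All.lookup Pxs))

  covered⇒count≤length : ∀ {xs} → (∀ {i} → P i → i ∈ xs) → count P? ≤ length xs
  covered⇒count≤length {xs} P⊆xs = ℕₚ.≤-trans (count-mono P? (_∈? xs) P⊆xs) (count-∈-≤ xs)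

∣tabulate∣≡count : ∀ {n} (f : Fin n → Bool) → ∣ tabulate f ∣ ≡ count (T? ∘ f)
∣tabulate∣≡count {zero}  f = refl
∣tabulate∣≡count {suc n} f with f zero
... | true  = cong suc (∣tabulate∣≡count (f ∘ suc))
... | false = ∣tabulate∣≡count (f ∘ suc)

-- Partitions into blocks of equal size

least-witness : ∀ {n p} {P : Pred (Fin n) p} → Decidable P → ∀ {u} → P u →
                ∃ λ w → P w × (∀ {z} → P z → w Fin.≤ z)
least-witness {suc n} P? {u} Pu with P? zero | u
... | yes P0 | _     = zero , P0 , λ _ → z≤n
... | no ¬P0 | zero  = contradiction Pu ¬P0
... | no ¬P0 | suc u with least-witness (P? ∘ suc) Pu
...   | w , Pw , least = suc w , Pw , λ { {zero} P0 → contradiction P0 ¬P0 ; {suc z} Pz → s≤s (least Pz) }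

module _ {n ℓ} {_∼_ : Rel (Fin n) ℓ} (isDecEquivalence : IsDecEquivalence _∼_) where
  open IsDecEquivalence isDecEquivalence
    renaming (_≟_ to _∼?_; refl to ∼-refl; sym to ∼-sym; trans to ∼-trans)

  private
    IsLeast : Pred (Fin n) ℓ
    IsLeast v = ∀ u → u ∼ v → v Fin.≤ u

    isLeast? : Decidable IsLeast
    isLeast? v = Finₚ.all? λ u → (u ∼? v) →-dec (v Fin.≤? u)

    one-least-per-class : ∀ u → count (λ v → (u ∼? v) ×-dec isLeast? v) ≡ 1
    one-least-per-class u with least-witness (u ∼?_) {u} ∼-refl
    ... | w , u∼w , w-least = count-unique (λ v → (u ∼? v) ×-dec isLeast? v)
      (u∼w , λ z z∼w → w-least (∼-trans u∼w (∼-sym z∼w)))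
      (λ { (u∼v , v-least) → Finₚ.≤-antisym (v-least w (∼-trans (∼-sym u∼w) u∼v)) (w-least u∼v) })

  -- Each class is counted once, through its least element.
  equal-size-classes⇒∣ : ∀ {k} → (∀ v → count (_∼? v) ≡ k) → k ∣ n
  equal-size-classes⇒∣ {k} size = divides (count isLeast?) (begin
    n
      ≡⟨ trans (∑-const n 1) (ℕₚ.*-identityʳ n) ⟨
    ∑[ u < n ] 1
      ≡⟨ sum-cong-≗ one-least-per-class ⟨
    ∑[ u < n ] ∑[ v < n ] indicator ((u ∼? v) ×-dec isLeast? v)
      ≡⟨ ∑-comm (λ u v → indicator ((u ∼? v) ×-dec isLeast? v)) ⟩
    ∑[ v < n ] ∑[ u < n ] indicator ((u ∼? v) ×-dec isLeast? v)
      ≡⟨ sum-cong-≗ class-count ⟩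
    ∑[ v < n ] (indicator (isLeast? v) * k)
      ≡⟨ *-distribʳ-sum k (λ v → indicator (isLeast? v)) ⟨
    count isLeast? * k ∎)
    where
    open ≡-Reasoning
    class-count : ∀ v → ∑[ u < n ] indicator ((u ∼? v) ×-dec isLeast? v) ≡ indicator (isLeast? v) * k
    class-count v = begin
      ∑[ u < n ] indicator ((u ∼? v) ×-dec isLeast? v)
        ≡⟨ sum-cong-≗ (λ u → indicator-× (u ∼? v) (isLeast? v)) ⟩
      ∑[ u < n ] (indicator (u ∼? v) * indicator (isLeast? v))
        ≡⟨ *-distribʳ-sum (indicator (isLeast? v)) (λ u → indicator (u ∼? v)) ⟨
      count (_∼? v) * indicator (isLeast? v)
        ≡⟨ cong (_* indicator (isLeast? v)) (size v) ⟩
      k * indicator (isLeast? v)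
        ≡⟨ ℕₚ.*-comm k (indicator (isLeast? v)) ⟩
      indicator (isLeast? v) * k ∎

module _ {n k} (block : Fin n → List (Fin n)) (∈-block : ∀ v → v ∈ block v)
         (block-closed : ∀ {u v w} → u ∈ block v → w ∈ block v → w ∈ block u)
         (unique : ∀ v → Unique (block v)) (size : ∀ v → length (block v) ≡ k) where

  equal-size-blocks⇒∣ : k ∣ n
  equal-size-blocks⇒∣ = equal-size-classes⇒∣ {_∼_ = λ u v → u ∈ block v} record
    { isEquivalence = record { refl = ∈-block _ ; sym = block-sym ; trans = block-trans }
    ; _≟_           = λ u v → u ∈? block v
    }
    (λ v → trans (count-∈ (unique v)) (size v))
    where
    block-sym : ∀ {u v} → u ∈ block v → v ∈ block u
    block-sym {v = v} u∈v = block-closed u∈v (∈-block v)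
    block-trans : ∀ {u v w} → u ∈ block v → v ∈ block w → u ∈ block w
    block-trans u∈v v∈w = block-closed (block-sym v∈w) u∈v

fixed-point-free-involution⇒2∣ : ∀ {n} (τ : Fin n → Fin n) →
  (∀ v → τ (τ v) ≡ v) → (∀ v → τ v ≢ v) → 2 ∣ n
fixed-point-free-involution⇒2∣ {n} τ ττ≡id τ≢id =
  equal-size-blocks⇒∣ pair (λ v → here refl) pair-closed
    (λ v → ((λ v≡τv → τ≢id v (sym v≡τv)) ∷ []) ∷ [] ∷ []) (λ v → refl)
  where
  pair : Fin n → List (Fin n)
  pair v = v ∷ τ v ∷ []
  pair-closed : ∀ {u v w} → u ∈ pair v → w ∈ pair v → w ∈ pair u
  pair-closed (here refl)         (here refl)         = here refl
  pair-closed (here refl)         (there (here refl)) = there (here refl)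
  pair-closed (there (here refl)) (here refl)         = there (here (sym (ττ≡id _)))
  pair-closed (there (here refl)) (there (here refl)) = here refl

∣⇒≡*suc : ∀ {m n} → m ∣ n → 0 < n → ∃ λ k → n ≡ m * suc k
∣⇒≡*suc {m} (divides zero    refl)  ()
∣⇒≡*suc {m} (divides (suc k) n≡km) _ = k , trans n≡km (ℕₚ.*-comm (suc k) m)

covering-list⇒≤length : ∀ {n} (xs : List (Fin n)) → (∀ v → v ∈ xs) → n ≤ length xs
covering-list⇒≤length xs covers = Finₚ.injective⇒≤ {f = λ v → index (covers v)} injective
  where
  injective : ∀ {u v} → index (covers u) ≡ index (covers v) → u ≡ v
  injective {u} {v} eq = trans (lookup-index (covers u)) (trans (cong (lookup xs) eq) (sym (lookup-index (covers v))))

-- Graphs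

module _ {n} (G : Graph n) where
  open Graph G using (adj; irrefl) renaming (sym to adj-sym)

  infix 4 _~_ _~?_ _∈N[_]

  _~_ : Fin n → Fin n → Set
  _~_ = Adj G

  _~?_ : ∀ u v → Dec (u ~ v)
  u ~? v = T? (adj u v)

  ~-sym : ∀ {u v} → u ~ v → v ~ u
  ~-sym {u} {v} = subst T (adj-sym u v)

  ~-irrefl : ∀ {v} → ¬ v ~ v
  ~-irrefl {v} = subst T (irrefl v)

  ~⇒≢ : ∀ {u v} → u ~ v → u ≢ v
  ~⇒≢ u~v refl = ~-irrefl u~v

  connected-closed⇒everything : ∀ {P : Pred (Fin n) 0ℓ} → Connected G →
    (∀ {u v} → P u → u ~ v → P v) → ∀ {u} → P u → ∀ v → P v
  connected-closed⇒everything {P} conn closed {u} Pu v = along (conn u v) Pu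
    where
    along : ∀ {x y} → Star _~_ x y → P x → P y
    along ε           Px = Px
    along (x~z ◅ z~y) Px = along z~y (closed Px x~z)

  _∈N[_] : Fin n → Fin n → Set
  u ∈N[ v ] = Defs._∈N[_] G u v

  ∈N-sym : ∀ {u v} → u ∈N[ v ] → v ∈N[ u ]
  ∈N-sym (inj₁ u≡v) = inj₁ (sym u≡v)
  ∈N-sym (inj₂ v~u) = inj₂ (~-sym v~u)

  _∈N[_]? : ∀ u v → Dec (u ∈N[ v ])
  u ∈N[ v ]? = (u ≟ v) ⊎-dec (v ~? u)

  N[_]⊆N[_] : Fin n → Fin n → Set
  N[ x ]⊆N[ y ] = ∀ {u} → u ∈N[ x ] → u ∈N[ y ]

  Triangle : Fin n → Fin n → Fin n → Set
  Triangle x y z = x ~ y × y ~ z × x ~ z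

  rotate : ∀ {x y z} → Triangle x y z → Triangle y z x
  rotate (x~y , y~z , x~z) = y~z , ~-sym x~z , ~-sym x~y

  flip : ∀ {x y z} → Triangle x y z → Triangle x z y
  flip (x~y , y~z , x~z) = x~z , ~-sym y~z , x~y

  InTriangle : Fin n → Set
  InTriangle x = ∃₂ (Triangle x)

  -- N(v) ⊆ N(y); in a cubic graph this makes v and y twins.
  Twin : Fin n → Fin n → Set
  Twin v y = v ≢ y × (∀ {u} → v ~ u → y ~ u)

  record ForcingPair (v x y : Fin n) : Set where
    constructor forcing
    field
      x≢y          : x ≢ y
      v∈N[x]       : v ∈N[ x ]
      v∉N[y]       : ¬ v ∈N[ y ]
      N[x]-v⊆N[y]  : ∀ {u} → u ∈N[ x ] → u ≢ v → u ∈N[ y ]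

  Forced : Fin n → Set
  Forced v = ∃₂ λ x y → x ≢ y × (∀ u → u ∈N[ x ] → u ≢ v → u ∈N[ y ])

  forced? : ∀ v → Dec (Forced v)
  forced? v = Finₚ.any? λ x → Finₚ.any? λ y → ¬? (x ≟ y) ×-dec
    Finₚ.all? (λ u → u ∈N[ x ]? →-dec (¬? (u ≟ v) →-dec u ∈N[ y ]?))

  SIC⊤⇒incomparable : IsSIC G ⊤ → ∀ {x y} → x ≢ y → ¬ N[ x ]⊆N[ y ]
  SIC⊤⇒incomparable sic {x} {y} x≢y N[x]⊆N[y] =
    x≢y (sym (proj₁ (proj₂ (sic x)) y λ u _ u∈N[x] → ∈N-sym (N[x]⊆N[y] u∈N[x])))

  ¬forced⇒deletion-SIC : (∀ x → ∃ (x ~_)) → ∀ {v} → ¬ Forced v → IsSIC G (⊤ - v)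
  ¬forced⇒deletion-SIC has-nbr {v} ¬forced x = dominated , separated , λ _ _ → ∈N-sym
    where
    kept : ∀ {u} → u ≢ v → u ∈ₛ ⊤ - v
    kept = Subsetₚ.x∈p∧x≢y⇒x∈p-y Subsetₚ.∈⊤

    dominated : ∃ λ u → u ∈ₛ ⊤ - v × u ∈N[ x ]
    dominated with x ≟ v | has-nbr x
    ... | yes refl | u , x~u = u , kept (~⇒≢ (~-sym x~u)) , inj₂ x~u
    ... | no x≢v   | _       = x , kept x≢v , inj₁ refl

    separated : ∀ y → (∀ u → u ∈ₛ ⊤ - v → u ∈N[ x ] → y ∈N[ u ]) → y ≡ x
    separated y y∈N[S∩N[x]] with y ≟ x
    ... | yes y≡x = y≡x
    ... | no y≢x  = contradiction
      (x , y , y≢x ∘ sym , λ u u∈N[x] u≢v → ∈N-sym (y∈N[S∩N[x]] u (kept u≢v) u∈N[x])) ¬forced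

  SIC-number-n⇒forced : SICNumber G n → (∀ x → ∃ (x ~_)) → ∀ v → Forced v
  SIC-number-n⇒forced (_ , minimum) has-nbr v = decidable-stable (forced? v) λ ¬forced →
    ℕₚ.<⇒≱ deletion-smaller (minimum (⊤ - v) (¬forced⇒deletion-SIC has-nbr ¬forced))
    where
    deletion-smaller : ∣ ⊤ - v ∣ < n
    deletion-smaller = subst (∣ ⊤ - v ∣ <_) (Subsetₚ.∣⊤∣≡n n)
      (Subsetₚ.x∈p⇒∣p-x∣<∣p∣ {p = ⊤ {n}} (Subsetₚ.∈⊤ {x = v}))

  SIC-number-n⇒SIC⊤ : SICNumber G n → IsSIC G ⊤
  SIC-number-n⇒SIC⊤ ((S , sic , ∣S∣≡n) , _) = subst (IsSIC G) (Subsetₚ.∣p∣≡n⇒p≡⊤ ∣S∣≡n) sic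

  module _ (cubic : Cubic G) where

    degree≡3 : ∀ v → count (v ~?_) ≡ 3
    degree≡3 v = trans (sym (∣tabulate∣≡count (adj v))) (cubic v)

    nbr-outside : ∀ v (xs : List (Fin n)) → length xs < 3 → ∃ λ u → v ~ u × u ∉ xs
    nbr-outside v xs |xs|<3 with Finₚ.any? (λ u → (v ~? u) ×-dec ¬? (u ∈? xs))
    ... | yes (u , v~u , u∉xs) = u , v~u , u∉xs
    ... | no none = contradiction
      (subst (_≤ length xs) (degree≡3 v) (covered⇒count≤length (v ~?_) covered)) (ℕₚ.<⇒≱ |xs|<3)
      where
      covered : ∀ {u} → v ~ u → u ∈ xs
      covered {u} v~u = decidable-stable (u ∈? xs) λ u∉xs → none (u , v~u , u∉xs)

    nbr-avoiding : ∀ v p q → ∃ λ w → v ~ w × w ≢ p × w ≢ q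
    nbr-avoiding v p q with nbr-outside v (p ∷ q ∷ []) (s≤s (s≤s (s≤s z≤n)))
    ... | w , v~w , w∉pq = w , v~w , w∉pq ∘ here , w∉pq ∘ there ∘ here

    nbrs-exhaust : ∀ {v r s t} → r ≢ s → r ≢ t → s ≢ t → v ~ r → v ~ s → v ~ t →
                   ∀ {u} → v ~ u → u ∈ r ∷ s ∷ t ∷ []
    nbrs-exhaust {v} {r} {s} {t} r≢s r≢t s≢t v~r v~s v~t {u} v~u with u ∈? r ∷ s ∷ t ∷ []
    ... | yes u∈rst = u∈rst
    ... | no  u∉rst = contradiction (subst (4 ≤_) (degree≡3 v) four-nbrs) ℕₚ.1+n≰n
      where
      four-nbrs : 4 ≤ count (v ~?_)
      four-nbrs = unique-members⇒length≤count (v ~?_)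
        (¬Any⇒All¬ _ u∉rst ∷ (r≢s ∷ r≢t ∷ []) ∷ (s≢t ∷ []) ∷ [] ∷ [])
        (v~u ∷ v~r ∷ v~s ∷ v~t ∷ [])

    record Nbrs (v : Fin n) : Set where
      field
        {a b c}     : Fin n
        v~a         : v ~ a
        v~b         : v ~ b
        v~c         : v ~ c
        a≢b         : a ≢ b
        a≢c         : a ≢ c
        b≢c         : b ≢ c

    nbrs : ∀ v → Nbrs v
    nbrs v with nbr-avoiding v v v
    ... | a , v~a , _ , _ with nbr-avoiding v a a
    ... | b , v~b , b≢a , _ with nbr-avoiding v a b
    ... | c , v~c , c≢a , c≢b = record
      { v~a = v~a ; v~b = v~b ; v~c = v~c ; a≢b = b≢a ∘ sym ; a≢c = c≢a ∘ sym ; b≢c = c≢b ∘ sym }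

    has-nbr : ∀ v → ∃ (v ~_)
    has-nbr v = Nbrs.a (nbrs v) , Nbrs.v~a (nbrs v)

    module _ (sic : SICNumber G n) where

      incomparable : ∀ {x y} → x ≢ y → ¬ N[ x ]⊆N[ y ]
      incomparable = SIC⊤⇒incomparable (SIC-number-n⇒SIC⊤ sic)

      forcing-pair : ∀ v → ∃₂ (ForcingPair v)
      forcing-pair v with SIC-number-n⇒forced sic has-nbr v
      ... | x , y , x≢y , cover with v ∈N[ x ]? | v ∈N[ y ]?
      ... | no v∉N[x] | _ = ⊥-elim (incomparable x≢y N[x]⊆N[y])
        where
        N[x]⊆N[y] : N[ x ]⊆N[ y ]
        N[x]⊆N[y] {u} u∈N[x] = cover u u∈N[x] λ u≡v → v∉N[x] (subst (_∈N[ x ]) u≡v u∈N[x])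
      ... | yes v∈N[x] | yes v∈N[y] = ⊥-elim (incomparable x≢y N[x]⊆N[y])
        where
        N[x]⊆N[y] : N[ x ]⊆N[ y ]
        N[x]⊆N[y] {u} u∈N[x] with u ≟ v
        ... | yes refl = v∈N[y]
        ... | no u≢v   = cover u u∈N[x] u≢v
      ... | yes v∈N[x] | no v∉N[y] = x , y , forcing x≢y v∈N[x] v∉N[y] λ {u} → cover u

      -- Otherwise N[x] = {x, y, a, b} ⊆ N[y].
      two-triangles-on-edge : ∀ {x y a b} → Triangle x y a → Triangle x y b → a ≡ b
      two-triangles-on-edge {x} {y} {a} {b} (x~y , y~a , x~a) (_ , y~b , x~b) with a ≟ b
      ... | yes a≡b = a≡b
      ... | no  a≢b = ⊥-elim (incomparable (~⇒≢ x~y) N[x]⊆N[y])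
        where
        N[x]⊆N[y] : N[ x ]⊆N[ y ]
        N[x]⊆N[y] (inj₁ refl) = inj₂ (~-sym x~y)
        N[x]⊆N[y] (inj₂ x~u) with nbrs-exhaust (~⇒≢ y~a) (~⇒≢ y~b) a≢b x~y x~a x~b x~u
        ... | here refl                 = inj₁ refl
        ... | there (here refl)         = inj₂ y~a
        ... | there (there (here refl)) = inj₂ y~b

      triangle-unique : ∀ {x y a p q} → Triangle x y a → Triangle x p q → p ∈ y ∷ a ∷ []
      triangle-unique {x} {y} {a} (x~y , y~a , x~a) (x~p , p~q , x~q) with nbr-avoiding x y a
      ... | w , x~w , w≢y , w≢a = locate x~p p~q (exhaust x~p) (exhaust x~q)
        where
        exhaust : ∀ {u} → x ~ u → u ∈ y ∷ a ∷ w ∷ []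
        exhaust = nbrs-exhaust (~⇒≢ y~a) (w≢y ∘ sym) (w≢a ∘ sym) x~y x~a x~w
        locate : ∀ {p q} → x ~ p → p ~ q → p ∈ y ∷ a ∷ w ∷ [] → q ∈ y ∷ a ∷ w ∷ [] → p ∈ y ∷ a ∷ []
        locate _ _ (here p≡y) _ = here p≡y
        locate _ _ (there (here p≡a)) _ = there (here p≡a)
        locate x~w w~y (there (there (here refl))) (here refl) =
          contradiction (two-triangles-on-edge (x~y , y~a , x~a) (x~y , ~-sym w~y , x~w)) (w≢a ∘ sym)
        locate x~w w~a (there (there (here refl))) (there (here refl)) =
          contradiction (two-triangles-on-edge (x~a , ~-sym y~a , x~y) (x~a , ~-sym w~a , x~w)) (w≢y ∘ sym)
        locate _ w~w (there (there (here refl))) (there (there (here refl))) = contradiction w~w ~-irrefl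

      forcing⇒twin : ∀ {v y} → ForcingPair v v y → Twin v y
      forcing⇒twin {v} {y} (forcing v≢y _ v∉N[y] cover) =
        v≢y , λ v~u → in-N[y] v~u (cover (inj₂ v~u) (~⇒≢ (~-sym v~u)))
        where
        in-N[y] : ∀ {u} → v ~ u → u ∈N[ y ] → y ~ u
        in-N[y] v~y (inj₁ refl) = contradiction (inj₂ (~-sym v~y)) v∉N[y]
        in-N[y] _   (inj₂ y~u)  = y~u

      forcing⇒triangle : ∀ {v x y} → ForcingPair v x y → x ~ v → ∃ (Triangle x y)
      forcing⇒triangle {v} {x} {y} (forcing x≢y _ _ cover) x~v with cover (inj₁ refl) (~⇒≢ x~v) | nbr-avoiding x v y
      ... | inj₁ x≡y | _ = contradiction x≡y x≢y
      ... | inj₂ y~x | a , x~a , a≢v , a≢y with cover (inj₂ x~a) a≢v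
      ...   | inj₁ a≡y = contradiction a≡y a≢y
      ...   | inj₂ y~a = a , ~-sym y~x , y~a , x~a

      -- Take the forcing pair (x, y) of z: x = z would make y a twin of z, closing a second
      -- triangle on pq, so x is z's neighbour off the triangle and lies on the triangle xya.
      outer-nbr-in-triangle : ∀ {z p q} → Triangle z p q → ∃ λ x → z ~ x × x ≢ p × x ≢ q × InTriangle x
      outer-nbr-in-triangle {z} t@(z~p , p~q , z~q) with forcing-pair z
      ... | x , y , fp@(forcing _ (inj₁ refl) _ _) with forcing⇒twin fp
      ...   | z≢y , z⇒y = contradiction (two-triangles-on-edge (rotate t) (p~q , ~-sym (z⇒y z~q) , ~-sym (z⇒y z~p))) z≢y
      outer-nbr-in-triangle {z} t | x , y , fp@(forcing _ (inj₂ x~z) z∉N[y] _) with forcing⇒triangle fp x~z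
      ...   | a , tx = x , ~-sym x~z , x-outside (flip (rotate t)) , x-outside (rotate (rotate t)) , (y , a , tx)
        where
        x-outside : ∀ {r s} → Triangle r z s → x ≢ r
        x-outside tr refl with triangle-unique tx tr
        ... | here z≡y         = z∉N[y] (inj₁ z≡y)
        ... | there (here z≡a) = z∉N[y] (inj₂ (subst (y ~_) (sym z≡a) (proj₁ (proj₂ tx))))

      triangle-or-twin : ∀ v → InTriangle v ⊎ ∃ (Twin v)
      triangle-or-twin v with forcing-pair v
      ... | x , y , fp@(forcing _ (inj₁ refl) _ _) = inj₂ (y , forcing⇒twin fp)
      ... | x , y , fp@(forcing _ (inj₂ x~v) v∉N[y] _) with forcing⇒triangle fp x~v
      ...   | a , tx@(x~y , y~a , x~a) with outer-nbr-in-triangle tx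
      ...     | w , x~w , w≢y , w≢a , w-in-triangle
        with nbrs-exhaust (v∉N[y] ∘ inj₁) (λ v≡a → v∉N[y] (inj₂ (subst (y ~_) (sym v≡a) y~a))) (~⇒≢ y~a)
                          x~v x~y x~a x~w
      ...       | here refl                 = inj₁ w-in-triangle
      ...       | there (here w≡y)          = contradiction w≡y w≢y
      ...       | there (there (here w≡a))  = contradiction w≡a w≢a

      -- A twin y of v leaves N(v) independent, and each neighbour of v then has a twin inside
      -- N(v); this closes off the six vertices of a K₃,₃.
      module Twins (conn : Connected G) {v y} (v≢y : v ≢ y) (y-covers : ∀ {u} → v ~ u → y ~ u) where
        open Nbrs (nbrs v)

        nbr-of-v : ∀ {u} → u ∈ a ∷ b ∷ c ∷ [] → v ~ u
        nbr-of-v = All.lookup (v~a ∷ v~b ∷ v~c ∷ [])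

        v-nbrs : ∀ {u} → v ~ u → u ∈ a ∷ b ∷ c ∷ []
        v-nbrs = nbrs-exhaust a≢b a≢c b≢c v~a v~b v~c

        y-nbrs : ∀ {u} → y ~ u → u ∈ a ∷ b ∷ c ∷ []
        y-nbrs = nbrs-exhaust a≢b a≢c b≢c (y-covers v~a) (y-covers v~b) (y-covers v~c)

        nbr-nbrs : ∀ {u w} → v ~ u → u ~ w → w ≢ v → w ≢ y → ∀ {z} → u ~ z → z ∈ v ∷ y ∷ w ∷ []
        nbr-nbrs v~u u~w w≢v w≢y =
          nbrs-exhaust v≢y (w≢v ∘ sym) (w≢y ∘ sym) (~-sym v~u) (~-sym (y-covers v~u)) u~w

        nbrs-nonadjacent : ∀ {u s} → v ~ u → v ~ s → ¬ u ~ s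
        nbrs-nonadjacent v~u v~s u~s = v≢y (two-triangles-on-edge
          (u~s , ~-sym v~s , ~-sym v~u) (u~s , ~-sym (y-covers v~s) , ~-sym (y-covers v~u)))

        nbr-not-in-triangle : ∀ {u} → v ~ u → ¬ InTriangle u
        nbr-not-in-triangle {u} v~u (r , s , u~r , r~s , u~s) with nbr-avoiding u v y
        ... | w , u~w , w≢v , w≢y = locate u~r u~s r~s (exhaust u~r) (exhaust u~s)
          where
          exhaust : ∀ {z} → u ~ z → z ∈ v ∷ y ∷ w ∷ []
          exhaust = nbr-nbrs v~u u~w w≢v w≢y
          through-v-or-y : ∀ {r s} → u ~ s → r ~ s → r ∈ v ∷ y ∷ [] → ⊥
          through-v-or-y u~s v~s (here refl)         = nbrs-nonadjacent v~u v~s u~s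
          through-v-or-y u~s y~s (there (here refl)) = nbrs-nonadjacent v~u (nbr-of-v (y-nbrs y~s)) u~s
          locate : ∀ {r s} → u ~ r → u ~ s → r ~ s → r ∈ v ∷ y ∷ w ∷ [] → s ∈ v ∷ y ∷ w ∷ [] → ⊥
          locate _   u~s r~s (here r≡v)                  _ = through-v-or-y u~s r~s (here r≡v)
          locate _   u~s r~s (there (here r≡y))          _ = through-v-or-y u~s r~s (there (here r≡y))
          locate u~r _   r~s (there (there (here refl))) (here s≡v) = through-v-or-y u~r (~-sym r~s) (here s≡v)
          locate u~r _   r~s (there (there (here refl))) (there (here s≡y)) = through-v-or-y u~r (~-sym r~s) (there (here s≡y))
          locate _   _   w~w (there (there (here refl))) (there (there (here refl))) = ~-irrefl w~w

        nbr-twin : ∀ {u} → v ~ u → ∃ λ t → v ~ t × u ≢ t × (∀ {z} → u ~ z → t ~ z)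
        nbr-twin {u} v~u with triangle-or-twin u
        ... | inj₁ u-in-triangle   = contradiction u-in-triangle (nbr-not-in-triangle v~u)
        ... | inj₂ (t , u≢t , u⇒t) = t , ~-sym (u⇒t (~-sym v~u)) , u≢t , u⇒t

        -- w is the third neighbour of a; the twins force it to be the third neighbour of b and c too.
        module _ {w} (a~w : a ~ w) (w≢v : w ≢ v) (w≢y : w ≢ y) where

          twin-adjacent-to-w : ∀ {u t} → v ~ u → v ~ t → (∀ {z} → u ~ z → t ~ z) → t ~ w → u ~ w
          twin-adjacent-to-w {u} v~u v~t u⇒t t~w with nbr-avoiding u v y
          ... | w′ , u~w′ , w′≢v , w′≢y with nbr-nbrs v~t t~w w≢v w≢y (u⇒t u~w′)
          ...   | here w′≡v                 = contradiction w′≡v w′≢v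
          ...   | there (here w′≡y)         = contradiction w′≡y w′≢y
          ...   | there (there (here refl)) = u~w′

          nbrs-adjacent-to-w : ∀ {r} → v ~ r → r ~ w
          nbrs-adjacent-to-w {r} v~r with r ~? w
          ... | yes r~w = r~w
          ... | no ¬r~w with nbr-twin v~r | nbr-twin v~a
          ...   | t , v~t , r≢t , r⇒t | tₐ , v~tₐ , a≢tₐ , a⇒tₐ =
            ⊥-elim (All¬⇒¬Any
              (a≢tₐ ∘ sym ∷ adjacent≢nonadjacent tₐ~w ¬r~w ∷ adjacent≢nonadjacent tₐ~w ¬t~w ∷ [])
              (nbrs-exhaust (adjacent≢nonadjacent a~w ¬r~w) (adjacent≢nonadjacent a~w ¬t~w) r≢t v~a v~r v~t v~tₐ))
            where
            adjacent≢nonadjacent : ∀ {p q} → p ~ w → ¬ q ~ w → p ≢ q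
            adjacent≢nonadjacent p~w ¬q~w p≡q = ¬q~w (subst (_~ w) p≡q p~w)
            ¬t~w : ¬ t ~ w
            ¬t~w t~w = ¬r~w (twin-adjacent-to-w v~r v~t r⇒t t~w)
            tₐ~w : tₐ ~ w
            tₐ~w = a⇒tₐ a~w

          region : List (Fin n)
          region = (v ∷ y ∷ w ∷ []) ++ (a ∷ b ∷ c ∷ [])

          region-closed : ∀ {z z′} → z ∈ region → z ~ z′ → z′ ∈ region
          region-closed (here refl)                 v~z′ = ∈-++⁺ʳ (v ∷ y ∷ w ∷ []) (v-nbrs v~z′)
          region-closed (there (here refl))         y~z′ = ∈-++⁺ʳ (v ∷ y ∷ w ∷ []) (y-nbrs y~z′)
          region-closed (there (there (here refl))) w~z′ = ∈-++⁺ʳ (v ∷ y ∷ w ∷ [])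
            (nbrs-exhaust a≢b a≢c b≢c (~-sym (nbrs-adjacent-to-w v~a)) (~-sym (nbrs-adjacent-to-w v~b))
              (~-sym (nbrs-adjacent-to-w v~c)) w~z′)
          region-closed (there (there (there z∈abc))) z~z′ = ∈-++⁺ˡ
            (nbr-nbrs (nbr-of-v z∈abc) (nbrs-adjacent-to-w (nbr-of-v z∈abc)) w≢v w≢y z~z′)

          n≤length-region : n ≤ length region
          n≤length-region = covering-list⇒≤length region
            (connected-closed⇒everything {P = _∈ region} conn region-closed (here refl))

        n≤6 : n ≤ 6
        n≤6 with nbr-avoiding a v y
        ... | w , a~w , w≢v , w≢y = n≤length-region a~w w≢v w≢y

      no-twin : Connected G → 7 ≤ n → ∀ {v y} → ¬ Twin v y
      no-twin conn 7≤n (v≢y , y-covers) = ℕₚ.<⇒≱ 7≤n (Twins.n≤6 conn v≢y y-covers)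

      module _ (conn : Connected G) (7≤n : 7 ≤ n) where

        opaque
          in-triangle : ∀ v → InTriangle v
          in-triangle v with triangle-or-twin v
          ... | inj₁ v-in-triangle = v-in-triangle
          ... | inj₂ (y , twin)    = contradiction twin (no-twin conn 7≤n)

        mate₁ mate₂ : Fin n → Fin n
        mate₁ v = proj₁ (in-triangle v)
        mate₂ v = proj₁ (proj₂ (in-triangle v))

        triangle-at : ∀ v → Triangle v (mate₁ v) (mate₂ v)
        triangle-at v = proj₂ (proj₂ (in-triangle v))

        triangle : Fin n → List (Fin n)
        triangle v = v ∷ mate₁ v ∷ mate₂ v ∷ []

        ∈triangle : ∀ {u w x} → Triangle u w x → w ∈ triangle u
        ∈triangle t = there (triangle-unique (triangle-at _) t)

        triangle-closed : ∀ {p q r u w} → Triangle p q r →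
                          u ∈ p ∷ q ∷ r ∷ [] → w ∈ p ∷ q ∷ r ∷ [] → w ∈ triangle u
        triangle-closed t (here refl)                 (here refl)                 = here refl
        triangle-closed t (here refl)                 (there (here refl))         = ∈triangle t
        triangle-closed t (here refl)                 (there (there (here refl))) = ∈triangle (flip t)
        triangle-closed t (there (here refl))         (here refl)                 = ∈triangle (flip (rotate t))
        triangle-closed t (there (here refl))         (there (here refl))         = here refl
        triangle-closed t (there (here refl))         (there (there (here refl))) = ∈triangle (rotate t)
        triangle-closed t (there (there (here refl))) (here refl)                 = ∈triangle (rotate (rotate t))
        triangle-closed t (there (there (here refl))) (there (here refl))         = ∈triangle (flip (rotate (rotate t)))
        triangle-closed t (there (there (here refl))) (there (there (here refl))) = here refl

        triangle-sym : ∀ {u v} → u ∈ triangle v → v ∈ triangle u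
        triangle-sym {v = v} u∈ = triangle-closed (triangle-at v) u∈ (here refl)

        3∣n : 3 ∣ n
        3∣n = equal-size-blocks⇒∣ triangle (λ _ → here refl) (triangle-closed (triangle-at _))
          unique (λ _ → refl)
          where
          unique : ∀ v → Unique (triangle v)
          unique v with triangle-at v
          ... | v~p , p~q , v~q = (~⇒≢ v~p ∷ ~⇒≢ v~q ∷ []) ∷ (~⇒≢ p~q ∷ []) ∷ [] ∷ []

        outer-nbr-exists : ∀ v → ∃ λ w → v ~ w × w ∉ triangle v
        outer-nbr-exists v with nbr-avoiding v (mate₁ v) (mate₂ v)
        ... | w , v~w , w≢p , w≢q = w , v~w , All¬⇒¬Any (~⇒≢ (~-sym v~w) ∷ w≢p ∷ w≢q ∷ [])

        outer : Fin n → Fin n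
        outer v = proj₁ (outer-nbr-exists v)

        outer-nbr : ∀ v → v ~ outer v
        outer-nbr v = proj₁ (proj₂ (outer-nbr-exists v))

        outer∉triangle : ∀ v → outer v ∉ triangle v
        outer∉triangle v = proj₂ (proj₂ (outer-nbr-exists v))

        outer-involutive : ∀ v → outer (outer v) ≡ v
        outer-involutive v = locate (nbrs-exhaust (~⇒≢ p~q)
          (outer≢ ∘ there ∘ here ∘ sym) (outer≢ ∘ there ∘ there ∘ here ∘ sym)
          o~p o~q (outer-nbr (outer v)) (~-sym (outer-nbr v)))
          where
          o~p : outer v ~ mate₁ (outer v)
          o~p = proj₁ (triangle-at (outer v))
          p~q : mate₁ (outer v) ~ mate₂ (outer v)
          p~q = proj₁ (proj₂ (triangle-at (outer v)))
          o~q : outer v ~ mate₂ (outer v)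
          o~q = proj₂ (proj₂ (triangle-at (outer v)))
          outer≢ : outer (outer v) ∉ triangle (outer v)
          outer≢ = outer∉triangle (outer v)
          locate : v ∈ mate₁ (outer v) ∷ mate₂ (outer v) ∷ outer (outer v) ∷ [] → outer (outer v) ≡ v
          locate (here v≡p)                 = contradiction (triangle-sym (there (here v≡p))) (outer∉triangle v)
          locate (there (here v≡q))         = contradiction (triangle-sym (there (there (here v≡q)))) (outer∉triangle v)
          locate (there (there (here v≡w))) = sym v≡w

        2∣n : 2 ∣ n
        2∣n = fixed-point-free-involution⇒2∣ outer outer-involutive (λ v → ~⇒≢ (~-sym (outer-nbr v)))

mainTheorem13 : (n : ℕ) → 8 ≤ n → (G : Graph n) → Connected G → Cubic G →
                SICNumber G n → ∃ λ k → n ≡ 6 * suc k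
mainTheorem13 n 8≤n G conn cubic sic =
  -- lcm 2 3 reduces to 6
  ∣⇒≡*suc (lcm-least (2∣n G cubic sic conn 7≤n) (3∣n G cubic sic conn 7≤n))
          (ℕₚ.<-≤-trans (s≤s z≤n) 8≤n)
  where
  7≤n : 7 ≤ n
  7≤n = ℕₚ.<⇒≤ 8≤n
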